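{- Let $(\delta,K_1,K_2,C_0,C_1)$ be admissible parameters satisfying Case III with $C'>C+1$, where $C=\min(C_0,C_1)$, $C'=\max(C_0,C_1)$, and let $M$ be a magic distance. Let $\mathbf C$ be a cycle with distances $d_0,d_1,d_2,x_1,\dots,x_k$ such that either $\mathbf C$ has even perimeter and $d_0+d_1+d_2>(C_0-1)+\sum_{i=1}^kx_i$, or $\mathbf C$ has odd perimeter and $d_0+d_1+d_2>(C_1-1)+\sum_{i=1}^kx_i$. If $\mathbf C$ has at least 4 vertices, then $\mathbf C$ has a tension.
   Context: A $\delta$-edge-labelled cycle is a cycle graph (at least 3 vertices) with edge labels in $\{1,\dots,\delta\}$; it "has distances $d_1,\dots,d_m$" if its edges can be listed in some (arbitrary) order with these labels; its perimeter is the sum of labels. Two edges are neighbouring if they share a vertex. Parameters: integers with $3\le\delta<\infty$, $1\le K_1\le K_2\le\delta$, $2\delta+2\le C_0,C_1\le3\delta+2$, $C_0$ even, $C_1$ odd. Case III (admissible) means: $C>2\delta+K_1$, $K_1+2K_2\ge2\delta-1$, $3K_2\ge2\delta$, if $K_1+2K_2=2\delta-1$ then $C\ge2\delta+K_1+2$, and if $C'>C+1$ then $C\ge2\delta+K_2$. Magic distance: $M\in\{1,\dots,\delta\}$ with $\max(K_1,\lceil\delta/2\rceil)\le M\le\min(K_2,\lfloor(C-\delta-1)/2\rfloor)$, such that moreover $M>K_1$ if $K_1+2K_2=2\delta-1$, and $M<K_2$ if $C=2\delta+K_2$ (here $C'>C+1$). Operation: $x\oplus y=|x-y|$ if $|x-y|>M$;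 otherwise $\min(x+y,C-1-x-y)$ if this is $<M$; otherwise $M$. A cycle has a tension if it has neighbouring edges with labels $a,b$ such that $a\oplus b\ne M$. -}

module Defs where

open import Data.Nat using (ℕ; zero; suc; _+_; _*_; _∸_; _≤_; _<_; _⊓_; _⊔_; _<ᵇ_; ∣_-_∣; ⌊_/2⌋; ⌈_/2⌉)
open import Data.Nat.Divisibility using (_∣_)
open import Data.Bool using (if_then_else_)
open import Data.Fin using (Fin; toℕ)
open import Data.Vec using (Vec; lookup; toList)
open import Data.List using (List; _∷_)
open import Data.Nat.ListAction using (sum)
open import Data.List.Relation.Binary.Permutation.Propositional using (_↭_)
open import Data.Product using (_×_; Σ; ∃₂)
open import Data.Sum using (_⊎_)
open import Relation.Binary.PropositionalEquality using (_≡_; _≢_)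
open import Relation.Nullary using (¬_)

record Admissible (δ K₁ K₂ C₀ C₁ : ℕ) : Set where
  field
    δ≥3   : 3 ≤ δ
    1≤K₁  : 1 ≤ K₁
    K₁≤K₂ : K₁ ≤ K₂
    K₂≤δ  : K₂ ≤ δ
    C₀≥   : 2 * δ + 2 ≤ C₀
    C₀≤   : C₀ ≤ 3 * δ + 2
    C₁≥   : 2 * δ + 2 ≤ C₁
    C₁≤   : C₁ ≤ 3 * δ + 2
    C₀even : 2 ∣ C₀
    C₁odd  : ¬ (2 ∣ C₁)

record CaseIII (δ K₁ K₂ C C' : ℕ) : Set where
  field
    c1 : 2 * δ + K₁ < C
    c2 : 2 * δ ∸ 1 ≤ K₁ + 2 * K₂
    c3 : 2 * δ ≤ 3 * K₂
    c4 : K₁ + 2 * K₂ ≡ 2 * δ ∸ 1 → 2 * δ + K₁ + 2 ≤ C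
    c5 : C + 1 < C' → 2 * δ + K₂ ≤ C

record Magic (δ K₁ K₂ C C' M : ℕ) : Set where
  field
    m1 : 1 ≤ M
    m2 : M ≤ δ
    m3 : K₁ ⊔ ⌈ δ /2⌉ ≤ M
    m4 : M ≤ K₂ ⊓ ⌊ C ∸ δ ∸ 1 /2⌋
    m5 : K₁ + 2 * K₂ ≡ 2 * δ ∸ 1 → K₁ < M
    m6 : C + 1 < C' → C ≡ 2 * δ + K₂ → M < K₂

op : (M C x y : ℕ) → ℕ
op M C x y =
  if M <ᵇ ∣ x - y ∣ then ∣ x - y ∣
  else (if ((x + y) ⊓ (C ∸ 1 ∸ (x + y))) <ᵇ M then (x + y) ⊓ (C ∸ 1 ∸ (x + y)) else M)

-- A δ-edge-labelled cycle on n vertices is given by its edge labels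
-- e₀,…,e_{n-1} in cyclic order (edge i joins vertices i and i+1 mod n).
record LabelledCycle (δ n : ℕ) : Set where
  field
    n≥3    : 3 ≤ n
    label  : Vec ℕ n
    inRange : (i : Fin n) → 1 ≤ lookup label i × lookup label i ≤ δ

open LabelledCycle public

Consecutive : {n : ℕ} → Fin n → Fin n → Set
Consecutive {n} i j = toℕ j ≡ suc (toℕ i) ⊎ (suc (toℕ i) ≡ n × toℕ j ≡ 0)

Neighbouring : {n : ℕ} → Fin n → Fin n → Set
Neighbouring i j = Consecutive i j ⊎ Consecutive j i

HasDistances : {δ n : ℕ} → LabelledCycle δ n → List ℕ → Set
HasDistances G ds = toList (label G) ↭ ds

perimeter : {δ n : ℕ} → LabelledCycle δ n → ℕ
perimeter G = sum (toList (label G))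

HasTension : {δ n : ℕ} → (M C : ℕ) → LabelledCycle δ n → Set
HasTension M C G =
  ∃₂ λ i j → Neighbouring i j × op M C (lookup (label G) i) (lookup (label G) j) ≢ M

-- If three labels d₀, d₁, d₂ ≤ δ sum to more than (C − 1) + Σ xᵢ with 2δ + M < C, then each of
-- them exceeds M + S, where S = Σ xᵢ, while every xᵢ is at most S. So no label lies in the gap
-- (S, M + S], both sides of the gap are occupied (the cycle has a fourth edge), and going round
-- the cycle some label ≤ S is followed by a label > M + S. These two labels differ by more
-- than M, and for such labels x ⊕ y = |x − y| ≠ M.
module Submission where

open import Defs
open import Data.Nat
  using (ℕ; suc; _+_; _*_; _∸_; _≤_; _≰_; _<_; _⊓_; _⊔_; _<ᵇ_; ∣_-_∣; _≤?_; s≤s⁻¹)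
open import Data.Nat.Properties
open import Data.Nat.Divisibility using (_∣_)
open import Data.Nat.ListAction using (sum)
open import Data.Bool using (true)
open import Data.Fin using (toℕ; zero; suc)
open import Data.List using (List; []; _∷_; length)
open import Data.List.Relation.Unary.All as All using (All; []; _∷_)
open import Data.List.Relation.Unary.All.Properties using (++⁺; ++⁻ˡ)
open import Data.List.Relation.Unary.Any using (Any; here; there)
open import Data.List.Relation.Binary.Permutation.Propositional using (↭-sym)
open import Data.List.Relation.Binary.Permutation.Propositional.Properties
  using (All-resp-↭; Any-resp-↭; ↭-length)
open import Data.Vec using (Vec; lookup; _∷_; [])
open import Data.Vec.Properties using (length-toList)
import Data.Vec.Relation.Unary.All as Vecᴬ
import Data.Vec.Relation.Unary.All.Properties as Vecᴬₚ
import Data.Vec.Relation.Unary.Any as Vecᴱ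
import Data.Vec.Relation.Unary.Any.Properties as Vecᴱₚ
open import Data.Product using (_×_; _,_; ∃₂; proj₂)
import Data.Sum as Sum
open import Data.Sum using (_⊎_; inj₁; inj₂)
open import Data.Empty using (⊥-elim)
open import Function using (_∘_)
open import Relation.Nullary using (¬_; yes; no)
open import Relation.Unary using (Pred; Decidable; ∁)
open import Relation.Binary.PropositionalEquality using (_≡_; _≢_; refl; sym; trans; cong; subst)

far⇒op≢M : ∀ {M} C x y → M < ∣ x - y ∣ → op M C x y ≢ M
far⇒op≢M {M} C x y M<∣x-y∣ with M <ᵇ ∣ x - y ∣ | <⇒<ᵇ M<∣x-y∣
... | true | _ = >⇒≢ M<∣x-y∣

Straddle : ∀ {a ℓ} {A : Set a} → Pred A ℓ → A → A → Set ℓ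
Straddle P x y = (P x × ¬ P y) ⊎ (¬ P x × P y)

AdjacentStraddle : ∀ {a ℓ} {A : Set a} → Pred A ℓ → ∀ {n} → Vec A n → Set ℓ
AdjacentStraddle P v = ∃₂ λ i j → toℕ j ≡ suc (toℕ i) × Straddle P (lookup v i) (lookup v j)

module _ {a ℓ} {A : Set a} {P : Pred A ℓ} (P? : Decidable P) where

  adjacentStraddle-∷ : ∀ {n x} {v : Vec A n} → AdjacentStraddle P v → AdjacentStraddle P (x ∷ v)
  adjacentStraddle-∷ (i , j , j≡1+i , s) = suc i , suc j , cong suc j≡1+i , s

  adjacent-straddle : ∀ {n} {v : Vec A n} → Vecᴱ.Any P v → Vecᴱ.Any (∁ P) v → AdjacentStraddle P v
  adjacent-straddle {v = x ∷ v} = go x v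
    where
      go : ∀ {n} x (v : Vec A n) → Vecᴱ.Any P (x ∷ v) → Vecᴱ.Any (∁ P) (x ∷ v) →
        AdjacentStraddle P (x ∷ v)
      go x []      (Vecᴱ.here px) (Vecᴱ.here ¬px) = ⊥-elim (¬px px)
      go x (y ∷ v) p q with P? x | P? y
      ... | yes px | no ¬py = zero , suc zero , refl , inj₁ (px , ¬py)
      ... | no ¬px | yes py = zero , suc zero , refl , inj₂ (¬px , py)
      ... | yes px | yes py =
        adjacentStraddle-∷ (go y v (Vecᴱ.here py) (Vecᴱ.tail (λ ¬px → ¬px px) q))
      ... | no ¬px | no ¬py =
        adjacentStraddle-∷ (go y v (Vecᴱ.tail ¬px p) (Vecᴱ.here ¬py))

OutsideGap : ℕ → ℕ → ℕ → Set
OutsideGap M S w = w ≤ S ⊎ M + S < w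

above⇒≰ : ∀ M {S w} → M + S < w → w ≰ S
above⇒≰ M {S} M+S<w = <⇒≱ (≤-<-trans (m≤n+m S M) M+S<w)

below-above⇒far : ∀ {M S x y} → x ≤ S → M + S < y → M < ∣ y - x ∣
below-above⇒far {M} {S} {x} {y} x≤S M+S<y =
  <-≤-trans (m+n≤o⇒m≤o∸n (suc M) (≤-<-trans (+-monoʳ-≤ M x≤S) M+S<y)) (m∸n≤∣m-n∣ y x)

straddle⇒far : ∀ {M S x y} → OutsideGap M S x → OutsideGap M S y → Straddle (_≤ S) x y →
  M < ∣ x - y ∣
straddle⇒far _ (inj₁ y≤S) (inj₁ (_ , y≰S)) = ⊥-elim (y≰S y≤S)
straddle⇒far {x = x} {y} _ (inj₂ M+S<y) (inj₁ (x≤S , _)) =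
  subst (_ <_) (∣-∣-comm y x) (below-above⇒far x≤S M+S<y)
straddle⇒far (inj₁ x≤S) _ (inj₂ (x≰S , _)) = ⊥-elim (x≰S x≤S)
straddle⇒far (inj₂ M+S<x) _ (inj₂ (_ , y≤S)) = below-above⇒far y≤S M+S<x

tension-across-gap : ∀ {δ n M C S} (G : LabelledCycle δ n) →
  Vecᴬ.All (OutsideGap M S) (label G) → Vecᴱ.Any (_≤ S) (label G) →
  Vecᴱ.Any (M + S <_) (label G) → HasTension M C G
tension-across-gap {M = M} {C} {S} G outside small large
  with adjacent-straddle (_≤? S) small (Vecᴱ.map (above⇒≰ M) large)
... | i , j , j≡1+i , straddle =
  i , j , inj₁ (inj₁ j≡1+i) , far⇒op≢M C (lookup (label G) i) (lookup (label G) j)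
    (straddle⇒far (Vecᴬₚ.lookup⁺ outside i) (Vecᴬₚ.lookup⁺ outside j) straddle)

labels-≤δ : ∀ {δ n ds} (G : LabelledCycle δ n) → HasDistances G ds → All (_≤ δ) ds
labels-≤δ G distances = All-resp-↭ distances (Vecᴬₚ.toList⁺ (Vecᴬₚ.lookup⁻ (proj₂ ∘ inRange G)))

length-distances : ∀ {δ n ds} (G : LabelledCycle δ n) → HasDistances G ds → length ds ≡ n
length-distances G distances = trans (sym (↭-length distances)) (length-toList (label G))

all-≤-sum : ∀ xs → All (_≤ sum xs) xs
all-≤-sum []       = []
all-≤-sum (x ∷ xs) =
  m≤m+n x (sum xs) ∷ All.map (λ y≤ → ≤-trans y≤ (m≤n+m (sum xs) x)) (all-≤-sum xs)

some-≤-sum : ∀ xs → 1 ≤ length xs → Any (_≤ sum xs) xs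
some-≤-sum (x ∷ xs) _ = here (m≤m+n x (sum xs))

2δ+M<C : ∀ {δ K₁ K₂ C C' M} → CaseIII δ K₁ K₂ C C' → C + 1 < C' → Magic δ K₁ K₂ C C' M →
  2 * δ + M < C
2δ+M<C {δ} {M = M} caseIII C+1<C' magic with m≤n⇒m<n∨m≡n (CaseIII.c5 caseIII C+1<C')
... | inj₁ 2δ+K₂<C = ≤-<-trans (+-monoʳ-≤ (2 * δ) (≤-trans (Magic.m4 magic) (m⊓n≤m _ _))) 2δ+K₂<C
... | inj₂ 2δ+K₂≡C =
  subst (2 * δ + M <_) 2δ+K₂≡C (+-monoʳ-< (2 * δ) (Magic.m6 magic C+1<C' (sym 2δ+K₂≡C)))

⊓-excess : ∀ C₀ C₁ {S t} → (C₀ ∸ 1) + S < t ⊎ (C₁ ∸ 1) + S < t → (C₀ ⊓ C₁ ∸ 1) + S < t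
⊓-excess C₀ C₁ {S} (inj₁ h) = ≤-<-trans (+-monoˡ-≤ S (∸-monoˡ-≤ 1 (m⊓n≤m C₀ C₁))) h
⊓-excess C₀ C₁ {S} (inj₂ h) = ≤-<-trans (+-monoˡ-≤ S (∸-monoˡ-≤ 1 (m⊓n≤n C₀ C₁))) h

first-exceeds : ∀ {δ M C S a b c} → 2 * δ + M < C → (C ∸ 1) + S < a + b + c →
  b ≤ δ → c ≤ δ → M + S < a
first-exceeds {δ} {M} {C} {S} {a} {b} {c} 2δ+M<C excess b≤δ c≤δ =
  +-cancelˡ-< (2 * δ) (M + S) a (begin-strict
    2 * δ + (M + S) ≡⟨ +-assoc (2 * δ) M S ⟨
    2 * δ + M + S   ≤⟨ +-monoˡ-≤ S (∸-monoˡ-≤ 1 2δ+M<C) ⟩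
    (C ∸ 1) + S     <⟨ excess ⟩
    a + b + c       ≡⟨ +-assoc a b c ⟩
    a + (b + c)     ≤⟨ +-monoʳ-≤ a (+-mono-≤ b≤δ (≤-trans c≤δ (m≤m+n δ 0))) ⟩
    a + 2 * δ       ≡⟨ +-comm a (2 * δ) ⟩
    2 * δ + a       ∎)
  where open ≤-Reasoning

all-three-exceed : ∀ {δ M C S a b c} → 2 * δ + M < C → (C ∸ 1) + S < a + b + c →
  All (_≤ δ) (a ∷ b ∷ c ∷ []) → All (M + S <_) (a ∷ b ∷ c ∷ [])
all-three-exceed {C = C} {S} {a} {b} {c} 2δ+M<C excess (a≤δ ∷ b≤δ ∷ c≤δ ∷ []) =
    first-exceeds 2δ+M<C excess b≤δ c≤δ
  ∷ first-exceeds 2δ+M<C (subst ((C ∸ 1) + S <_) (cong (_+ c) (+-comm a b)) excess) a≤δ c≤δ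
  ∷ first-exceeds 2δ+M<C
      (subst ((C ∸ 1) + S <_) (trans (+-comm (a + b) c) (sym (+-assoc c a b))) excess) a≤δ b≤δ
  ∷ []

mainTheorem12 : (δ K₁ K₂ C₀ C₁ M : ℕ) →
    Admissible δ K₁ K₂ C₀ C₁ →
    CaseIII δ K₁ K₂ (C₀ ⊓ C₁) (C₀ ⊔ C₁) →
    (C₀ ⊓ C₁) + 1 < (C₀ ⊔ C₁) →
    Magic δ K₁ K₂ (C₀ ⊓ C₁) (C₀ ⊔ C₁) M →
    (n : ℕ) (G : LabelledCycle δ n) (d₀ d₁ d₂ : ℕ) (xs : List ℕ) →
    HasDistances G (d₀ ∷ d₁ ∷ d₂ ∷ xs) →
    ((2 ∣ perimeter G) × (C₀ ∸ 1) + sum xs < d₀ + d₁ + d₂)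
      ⊎ ((¬ (2 ∣ perimeter G)) × (C₁ ∸ 1) + sum xs < d₀ + d₁ + d₂) →
    4 ≤ n →
    HasTension M (C₀ ⊓ C₁) G
mainTheorem12 δ K₁ K₂ C₀ C₁ M _ caseIII C+1<C' magic n G d₀ d₁ d₂ xs distances excess 4≤n =
  tension-across-gap {C = C₀ ⊓ C₁} G outside (toLabels small) (toLabels (here (All.head large)))
  where
    toLabels : ∀ {P : Pred ℕ _} → Any P (d₀ ∷ d₁ ∷ d₂ ∷ xs) → Vecᴱ.Any P (label G)
    toLabels = Vecᴱₚ.toList⁻ ∘ Any-resp-↭ (↭-sym distances)

    large : All (M + sum xs <_) (d₀ ∷ d₁ ∷ d₂ ∷ [])
    large = all-three-exceed {C = C₀ ⊓ C₁} (2δ+M<C caseIII C+1<C' magic)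
      (⊓-excess C₀ C₁ (Sum.map proj₂ proj₂ excess))
      (++⁻ˡ (d₀ ∷ d₁ ∷ d₂ ∷ []) (labels-≤δ G distances))

    outside : Vecᴬ.All (OutsideGap M (sum xs)) (label G)
    outside = Vecᴬₚ.toList⁻ (All-resp-↭ (↭-sym distances)
      (++⁺ (All.map inj₂ large) (All.map inj₁ (all-≤-sum xs))))

    small : Any (_≤ sum xs) (d₀ ∷ d₁ ∷ d₂ ∷ xs)
    small = there (there (there (some-≤-sum xs
      (s≤s⁻¹ (s≤s⁻¹ (s≤s⁻¹ (subst (4 ≤_) (sym (length-distances G distances)) 4≤n)))))))
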